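{- Let $z^*$ be the item requested in some step and let $y$ be an item with $y\prec z^*$ just before the request. Then the state of the pair $\{z^*,y\}$ changes during the step (work function update, FPM's move and target updates) as follows. If FPM performs a partial move: $\alpha^d\to\beta^{ne}$; $\beta^d\to\gamma^{ne}$; $\alpha^{oe}\to$ one of $\beta^d,\beta^o,\beta^{ne}$; $\beta^o\to\alpha^{oe}$; $\beta^{ne}\to\alpha^d$; $\gamma^{ne}\to\alpha^d$. If FPM performs a full move: $\alpha^d\to\beta^d$; $\beta^d\to\alpha^d$; $\alpha^{oe}\to\beta^d$; $\beta^o\to\alpha^d$; $\beta^{ne}\to\alpha^d$; $\gamma^{ne}\to\alpha^d$.
   Context: List Update (uniform, partial cost model): accessing position $\ell$ costs $\ell-1$; adjacent swaps cost $1$. $a\prec b$ means $a$ is before $b$ in FPM's current list; $\preceq$ allows equality. For a pair $\{x,y\}$, $\sigma_{xy}$ is the subsequence of requests to $x$ or $y$; after each prefix of the input, $W^{xy}(xy)$ (resp. $W^{xy}(yx)$) is the minimum cost of serving the corresponding prefix of $\sigma_{xy}$ on a two-item list $\{x,y\}$ starting from their initial relative order and ending in configuration $xy$ (resp. $yx$). Mode of $\{x,y\}$ with $y\prec x$: $\alpha$ if $W^{xy}(yx)+1=W^{xy}(xy)$; $\beta$ if $W^{xy}(yx)=W^{xy}(xy)$; $\gamma$ if $W^{xy}(yx)-1=W^{xy}(xy)$. FPM keeps targets $\theta_x$ (initially $\theta_x=x$). On a request to $z^*$: (1) every $y\neq z^*$ with $\theta_y=z^*$ gets $\theta_y:=$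 successor of $z^*$; (2) partial move (insert $z^*$ immediately before $\theta_{z^*}$) or full move (move $z^*$ to front); (3) $\theta_{z^*}:=$ front item. Flavor of $\{x,y\}$ with $y\prec x$: $d$ if $\theta_y\preceq y\prec\theta_x\preceq x$; $o$ if $\theta_y\prec\theta_x\preceq y\prec x$; $e$ if $\theta_y=\theta_x\preceq y\prec x$; $n$ if $\theta_x\prec\theta_y\preceq y\prec x$. The state is $\xi^\omega$ with mode $\xi$ and flavor $\omega$; $\alpha^{oe}$ denotes "state $\alpha^o$ or $\alpha^e$", $\beta^{ne}$ denotes "$\beta^n$ or $\beta^e$", $\gamma^{ne}$ denotes "$\gamma^n$ or $\gamma^e$". Modes and flavors are always evaluated with respect to the current order (the earlier item of the pair plays the role of $y$). -}

module Defs where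

open import Data.Nat using (ℕ; zero; suc; _+_; _<_; _≤_; _⊓_; _<ᵇ_)
open import Data.Fin using (Fin; _≟_)
open import Data.Bool using (Bool; true; false; if_then_else_; _∧_; not)
open import Data.List using (List; []; _∷_; take; drop; _++_; filter; foldl; map; _∷ʳ_)
open import Data.Product using (_×_; _,_; proj₁; proj₂)
open import Data.Sum using (_⊎_)
open import Relation.Nullary using (does; ¬?)
open import Relation.Binary.PropositionalEquality using (_≡_)

private variable m : ℕ

_==_ : Fin m → Fin m → Bool
a == b = does (a ≟ b)

-- index of (the first occurrence of) z in L  (length L if absent)
pos : List (Fin m) → Fin m → ℕ
pos []       z = 0
pos (x ∷ xs) z = if x == z then 0 else suc (pos xs z)

_≺[_]_ : Fin m → List (Fin m) → Fin m → Set
a ≺[ L ] b = pos L a < pos L b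

_⪯[_]_ : Fin m → List (Fin m) → Fin m → Set
a ⪯[ L ] b = pos L a ≤ pos L b

-- the item directly after z in L (default z if there is none; never used
-- in that case, since targets always satisfy θ_v ⪯ v)
succOf : List (Fin m) → Fin m → Fin m
succOf []           z = z
succOf (x ∷ [])     z = z
succOf (x ∷ y ∷ xs) z = if x == z then y else succOf (y ∷ xs) z

front : List (Fin m) → Fin m → Fin m
front []      z = z
front (x ∷ _) _ = x

remove : Fin m → List (Fin m) → List (Fin m)
remove z = filter (λ x → ¬? (x ≟ z))

insertAt : ℕ → Fin m → List (Fin m) → List (Fin m)
insertAt k z xs = take k xs ++ (z ∷ drop k xs)

data Move : Set where
  partial full : Move

record Config (m : ℕ) : Set where
  constructor ⟨_,_⟩
  field
    lst : List (Fin m)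
    θ   : Fin m → Fin m
open Config public

-- one step of FPM on request z*, using the given kind of move
-- (1) every y ≠ z* with θ_y = z* gets θ_y := successor of z*
-- (2) partial move: insert z* immediately before θ_{z*}
--     (i.e. at the position θ_{z*} occupies; no move if θ_{z*} = z*);
--     full move: move z* to the front
-- (3) θ_{z*} := front item
fpmStep : Config m → Fin m × Move → Config m
fpmStep C (z , mv) = ⟨ L' , θ2 ⟩
  where
    L  = lst C
    θ1 : _ → _
    θ1 v = if not (v == z) ∧ (θ C v == z) then succOf L z else θ C v
    k : Move → ℕ
    k partial = pos L (θ1 z)
    k full    = 0
    L' = insertAt (k mv) z (remove z L)
    θ2 : _ → _
    θ2 v = if v == z then front L' z else θ1 v

initConfig : List (Fin m) → Config m
initConfig L = ⟨ L , (λ x → x) ⟩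

run : List (Fin m) → List (Fin m × Move) → Config m
run L0 = foldl fpmStep (initConfig L0)

-- Work functions of a pair {a,b}.
-- wf L0 a b σ = ( W^{ab}(ab) , W^{ab}(ba) ) after the request sequence σ,
-- for the two-item list {a,b} started in its relative order in L0.

accCost : Fin m → Fin m → Fin m → ℕ
accCost first second r = if r == first then 0 else 1

wfStep : Fin m → Fin m → ℕ × ℕ → Fin m → ℕ × ℕ
wfStep a b (p , q) r =
  if (r == a) Data.Bool.∨ (r == b)
  then ( (p + accCost a b r) ⊓ (q + accCost b a r + 1)
       , (q + accCost b a r) ⊓ (p + accCost a b r + 1) )
  else (p , q)

wf : List (Fin m) → Fin m → Fin m → List (Fin m) → ℕ × ℕ
wf L0 a b = foldl (wfStep a b) (if pos L0 a <ᵇ pos L0 b then (0 , 1) else (1 , 0))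

-- W(a b): minimum cost of serving σ_{ab} ending in configuration "a before b"
W : List (Fin m) → List (Fin m) → Fin m → Fin m → ℕ
W L0 σ a b = proj₁ (wf L0 a b σ)

data Mode : Set where
  α β γ : Mode

data Flavor : Set where
  d o e n : Flavor

ModeIs : ℕ → ℕ → Mode → Set
ModeIs Wyx Wxy α = suc Wyx ≡ Wxy
ModeIs Wyx Wxy β = Wyx ≡ Wxy
ModeIs Wyx Wxy γ = Wyx ≡ suc Wxy

FlavorIs : List (Fin m) → (Fin m → Fin m) → Fin m → Fin m → Flavor → Set
FlavorIs L θ y x d = θ y ⪯[ L ] y × y ≺[ L ] θ x × θ x ⪯[ L ] x
FlavorIs L θ y x o = θ y ≺[ L ] θ x × θ x ⪯[ L ] y × y ≺[ L ] x
FlavorIs L θ y x e = θ y ≡ θ x × θ x ⪯[ L ] y × y ≺[ L ] x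
FlavorIs L θ y x n = θ x ≺[ L ] θ y × θ y ⪯[ L ] y × y ≺[ L ] x

-- state ξ^ω of the pair with y ≺ x (y the earlier item), for initial list L0,
-- requests served so far σ, and FPM configuration C
StateIs : List (Fin m) → List (Fin m) → Config m → Fin m → Fin m → Mode → Flavor → Set
StateIs L0 σ C y x ξ ω = ModeIs (W L0 σ y x) (W L0 σ x y) ξ × FlavorIs (lst C) (θ C) y x ω

PairState : List (Fin m) → List (Fin m) → Config m → Fin m → Fin m → Mode → Flavor → Set
PairState L0 σ C a b ξ ω =
    (a ≺[ lst C ] b × StateIs L0 σ C a b ξ ω)
  ⊎ (b ≺[ lst C ] a × StateIs L0 σ C b a ξ ω)

Transitions : Move → (Mode → Flavor → Set) → (Mode → Flavor → Set) → Set
Transitions partial S T =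
    (S α d → T β n ⊎ T β e)
  × (S β d → T γ n ⊎ T γ e)
  × (S α o ⊎ S α e → T β d ⊎ T β o ⊎ T β n ⊎ T β e)
  × (S β o → T α o ⊎ T α e)
  × (S β n ⊎ S β e → T α d)
  × (S γ n ⊎ S γ e → T α d)
Transitions full S T =
    (S α d → T β d)
  × (S β d → T α d)
  × (S α o ⊎ S α e → T β d)
  × (S β o → T α d)
  × (S β n ⊎ S β e → T α d)
  × (S γ n ⊎ S γ e → T α d)

{-# OPTIONS --safe #-}
module Submission where

-- Serving z, the later item, turns (W(yz), W(zy)) = (p, q) into (min(p, q) + 1, min(q, p + 2)),
-- so the mode read with z first goes α ↦ β and β, γ ↦ α.  FPM moves z to a position k ≤ pos z:
-- the items at positions k … pos z − 1 move one step back, z's target becomes the front item,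
-- and y keeps its target, which lies before y and so is not z.  The new flavor is decided by k:
-- k ≤ pos θ_y gives d with z first, pos θ_y < k ≤ pos y gives o or e with z first, and
-- pos y < k keeps y first with flavor n or e.  A full move has k = 0, a partial one k = pos θ_z,
-- which the old flavor places relative to θ_y and y.

open import Defs
open import Data.Nat using (ℕ)
open import Data.Fin using (Fin)
open import Data.List using (List; map; _∷ʳ_; allFin)
open import Data.Product using (_×_; _,_; proj₁)
open import Data.List.Relation.Binary.Permutation.Propositional using (_↭_)
open import Data.Nat using (zero; suc; _<_; _≤_; _⊓_; _<ᵇ_; z≤n; s≤s)
open import Data.Nat.Properties
open import Data.Fin using () renaming (_≟_ to _≟F_)
open import Data.Bool using (true; false; if_then_else_)
open import Data.List using ([]; _∷_; length; take; foldl)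
open import Data.List.Properties using (foldl-∷ʳ)
open import Data.List.Membership.Propositional using (_∈_)
open import Data.List.Membership.Propositional.Properties using (∈-allFin; ∈-++⁺ʳ)
open import Data.List.Relation.Binary.Permutation.Propositional using (↭-sym)
open import Data.List.Relation.Binary.Permutation.Propositional.Properties using (∈-resp-↭)
open import Data.List.Relation.Unary.Any using (here; there)
open import Data.Product using (proj₂; swap)
open import Data.Sum using (_⊎_; inj₁; inj₂; [_,_]′)
open import Data.Empty using (⊥-elim)
open import Relation.Nullary using (yes; no; ofʸ; ofⁿ)
open import Relation.Nullary.Decidable using (dec-true; dec-false)
open import Relation.Binary.PropositionalEquality

private variable
  m : ℕ
  A B : Set
  a b v z : Fin m
  xs : List (Fin m)

==-refl : (a : Fin m) → (a == a) ≡ true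
==-refl a = dec-true (a ≟F a) refl

==-false : a ≢ b → (a == b) ≡ false
==-false {a = a} {b} = dec-false (a ≟F b)

pos≤length : (L : List (Fin m)) (v : Fin m) → pos L v ≤ length L
pos≤length []       v = z≤n
pos≤length (x ∷ xs) v with x ≟F v
... | yes _ = z≤n
... | no  _ = s≤s (pos≤length xs v)

pos-injective : a ∈ xs → pos xs a ≡ pos xs b → a ≡ b
pos-injective {a = a} {xs = x ∷ xs} {b} (here refl) eq with x ≟F x | x ≟F b
... | yes _   | yes x≡b = x≡b
... | no  x≢x | _       = ⊥-elim (x≢x refl)
pos-injective {a = a} {xs = x ∷ xs} {b} (there a∈xs) eq with x ≟F a | x ≟F b
... | yes x≡a | yes x≡b = trans (sym x≡a) x≡b
... | no  _   | no  _   = pos-injective a∈xs (suc-injective eq)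

pos-front : (L : List (Fin m)) (z : Fin m) → pos L (front L z) ≡ 0
pos-front []       z = refl
pos-front (x ∷ xs) z = cong (if_then 0 else suc (pos xs x)) (==-refl x)

front-∈ : z ∈ xs → front xs z ∈ xs
front-∈ {xs = _ ∷ _} _ = here refl

front-first : z ∈ xs → front xs z ≡ v ⊎ front xs z ≺[ xs ] v
front-first {z = z} {xs = xs} {v} z∈xs with pos xs v in eq
... | zero  = inj₁ (pos-injective (front-∈ z∈xs) (trans (pos-front xs z) (sym eq)))
... | suc _ = inj₂ (subst (_< suc _) (sym (pos-front xs z)) (s≤s z≤n))

pos-remove-< : (L : List (Fin m)) → pos L v < pos L z → pos (remove z L) v ≡ pos L v
pos-remove-< {v = v} {z} (x ∷ xs) v<z with x ≟F z
... | yes _ = ⊥-elim (n≮0 v<z)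
... | no  _ with x ≟F v
...   | yes _ = refl
...   | no  _ = cong suc (pos-remove-< xs (≤-pred v<z))

pos-remove-self : (L : List (Fin m)) (z : Fin m) → pos L z ≤ pos (remove z L) z
pos-remove-self []       z = z≤n
pos-remove-self (x ∷ xs) z with x ≟F z
... | yes _ = z≤n
... | no  x≢z rewrite ==-false x≢z = s≤s (pos-remove-self xs z)

pos-insertAt-self : (k : ℕ) (R : List (Fin m)) → k ≤ pos R z → pos (insertAt k z R) z ≡ k
pos-insertAt-self {z = z} zero    R       _ = cong (if_then 0 else suc (pos R z)) (==-refl z)
pos-insertAt-self {z = z} (suc k) (x ∷ R) k<z with x ≟F z
... | yes _ = ⊥-elim (n≮0 k<z)
... | no  _ = cong suc (pos-insertAt-self k R (≤-pred k<z))

pos-insertAt-< : (k : ℕ) (R : List (Fin m)) → pos R v < k → pos R v < length R →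
                 pos (insertAt k z R) v ≡ pos R v
pos-insertAt-< {v = v} (suc k) (x ∷ R) v<k v<len with x ≟F v
... | yes _ = refl
... | no  _ = cong suc (pos-insertAt-< k R (≤-pred v<k) (≤-pred v<len))

pos-insertAt-≥ : (k : ℕ) (R : List (Fin m)) → z ≢ v → k ≤ pos R v →
                 pos (insertAt k z R) v ≡ suc (pos R v)
pos-insertAt-≥ zero    R       z≢v _ = cong (if_then 0 else _) (==-false z≢v)
pos-insertAt-≥ {v = v} (suc k) (x ∷ R) z≢v k≤v with x ≟F v
... | yes _ = ⊥-elim (n≮0 k≤v)
... | no  _ = cong suc (pos-insertAt-≥ k R z≢v (≤-pred k≤v))

moveTo : ℕ → Fin m → List (Fin m) → List (Fin m)
moveTo k z L = insertAt k z (remove z L)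

∈-moveTo : (k : ℕ) (xs : List (Fin m)) → z ∈ moveTo k z xs
∈-moveTo k xs = ∈-++⁺ʳ (take k _) (here refl)

module _ (L : List (Fin m)) {z : Fin m} {k : ℕ} where

  pos-moveTo-self : k ≤ pos L z → pos (moveTo k z L) z ≡ k
  pos-moveTo-self k≤z = pos-insertAt-self k _ (≤-trans k≤z (pos-remove-self L z))

  pos-moveTo-< : pos L v < pos L z → pos L v < k → pos (moveTo k z L) v ≡ pos L v
  pos-moveTo-< {v = v} v<z v<k = begin
    pos (moveTo k z L) v ≡⟨ pos-insertAt-< k _ (subst (_< k) (sym v↦v) v<k) v<length ⟩
    pos (remove z L) v   ≡⟨ v↦v ⟩
    pos L v              ∎
    where
      open ≡-Reasoning
      v↦v = pos-remove-< L v<z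
      v<length = subst (_< _) (sym v↦v)
        (<-≤-trans v<z (≤-trans (pos-remove-self L z) (pos≤length (remove z L) z)))

  pos-moveTo-≥ : pos L v < pos L z → k ≤ pos L v → pos (moveTo k z L) v ≡ suc (pos L v)
  pos-moveTo-≥ {v = v} v<z k≤v = begin
    pos (moveTo k z L) v      ≡⟨ pos-insertAt-≥ k _ (λ z≡v → <-irrefl (cong (pos L) (sym z≡v)) v<z)
                                                    (subst (k ≤_) (sym v↦v) k≤v) ⟩
    suc (pos (remove z L) v)  ≡⟨ cong suc v↦v ⟩
    suc (pos L v)             ∎
    where
      open ≡-Reasoning
      v↦v = pos-remove-< L v<z

insertionPoint : Config m → Fin m → Move → ℕ
insertionPoint C z partial = pos (lst C) (θ C z)
insertionPoint C z full    = 0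

lst-fpmStep : (C : Config m) (z : Fin m) (mv : Move) →
              lst (fpmStep C (z , mv)) ≡ moveTo (insertionPoint C z mv) z (lst C)
lst-fpmStep C z partial rewrite ==-refl z = refl
lst-fpmStep C z full    = refl

θ-fpmStep-self : (C : Config m) (z : Fin m) (mv : Move) →
                 θ (fpmStep C (z , mv)) z ≡ front (lst (fpmStep C (z , mv))) z
θ-fpmStep-self C z mv rewrite ==-refl z = refl

θ-fpmStep-other : (C : Config m) (mv : Move) → v ≢ z → θ C v ≢ z → θ (fpmStep C (z , mv)) v ≡ θ C v
θ-fpmStep-other C mv v≢z θv≢z rewrite ==-false v≢z | ==-false θv≢z = refl

FlavorIs⇒θ⪯ : {t : Fin m → Fin m} (ω : Flavor) → FlavorIs xs t a b ω → t a ⪯[ xs ] a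
FlavorIs⇒θ⪯ d (θa⪯a , _) = θa⪯a
FlavorIs⇒θ⪯ o (θa≺θb , θb⪯a , _) = <⇒≤ (<-≤-trans θa≺θb θb⪯a)
FlavorIs⇒θ⪯ {xs = xs} {a = a} e (θa≡θb , θb⪯a , _) =
  subst (_≤ pos xs a) (cong (pos xs) (sym θa≡θb)) θb⪯a
FlavorIs⇒θ⪯ n (_ , θa⪯a , _) = θa⪯a

foldl-fusion : {f : A → B → A} {g : A → B → A} (h : A → A) →
               (∀ s r → g (h s) r ≡ h (f s r)) → ∀ s xs → foldl g (h s) xs ≡ h (foldl f s xs)
foldl-fusion         h fuse s []       = refl
foldl-fusion {f = f} {g} h fuse s (r ∷ xs) =
  trans (cong (λ t → foldl g t xs) (fuse s r)) (foldl-fusion h fuse (f s r) xs)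

wfStep-swap : (a b r : Fin m) (s : ℕ × ℕ) → wfStep b a (swap s) r ≡ swap (wfStep a b s r)
wfStep-swap a b r (p , q) with r == a | r == b
... | true  | true  = refl
... | true  | false = refl
... | false | true  = refl
... | false | false = refl

initialWf-swap : (i j : ℕ) → i ≢ j →
  (if j <ᵇ i then (0 , 1) else (1 , 0)) ≡ swap (if i <ᵇ j then (0 , 1) else (1 , 0))
initialWf-swap i j i≢j with i <ᵇ j | <ᵇ-reflects-< i j | j <ᵇ i | <ᵇ-reflects-< j i
... | true  | _        | false | _        = refl
... | false | _        | true  | _        = refl
... | true  | ofʸ i<j  | true  | ofʸ j<i  = ⊥-elim (<-asym i<j j<i)
... | false | ofⁿ i≮j  | false | ofⁿ j≮i  = ⊥-elim (i≢j (≤∧≮⇒≡ (≮⇒≥ j≮i) i≮j))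

wf-swap : (L0 σ : List (Fin m)) → a ∈ L0 → a ≢ b → wf L0 b a σ ≡ swap (wf L0 a b σ)
wf-swap {a = a} {b} L0 σ a∈L0 a≢b
  rewrite initialWf-swap (pos L0 a) (pos L0 b) (λ eq → a≢b (pos-injective a∈L0 eq))
  = foldl-fusion swap (λ s r → wfStep-swap a b r s) _ σ

wf-∷ʳ-second : (L0 σ : List (Fin m)) → b ≢ a →
  let (p , q) = wf L0 a b σ in wf L0 a b (σ ∷ʳ b) ≡ (suc p ⊓ suc q , q ⊓ suc (suc p))
wf-∷ʳ-second {b = b} {a} L0 σ b≢a
  rewrite foldl-∷ʳ (wfStep a b) (if pos L0 a <ᵇ pos L0 b then (0 , 1) else (1 , 0)) b σ
  with wf L0 a b σ
... | p , q rewrite ==-refl b | ==-false b≢a | +-identityʳ q | +-comm p 1 | +-comm q 1 | +-comm p 1 = refl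

module ServeLater (L0 σ : List (Fin m)) {y z : Fin m} (y∈L0 : y ∈ L0) (y≢z : y ≢ z) where
  private
    σ′ = σ ∷ʳ z
    p = proj₁ (wf L0 y z σ)
    q = proj₂ (wf L0 y z σ)

    W-zy : W L0 σ z y ≡ q
    W-zy = cong proj₁ (wf-swap L0 σ y∈L0 y≢z)

    W′-yz : W L0 σ′ y z ≡ suc p ⊓ suc q
    W′-yz = cong proj₁ (wf-∷ʳ-second L0 σ (λ z≡y → y≢z (sym z≡y)))

    W′-zy : W L0 σ′ z y ≡ q ⊓ suc (suc p)
    W′-zy = trans (cong proj₁ (wf-swap L0 σ′ y∈L0 y≢z))
                  (cong proj₂ (wf-∷ʳ-second L0 σ (λ z≡y → y≢z (sym z≡y))))

    mode-≥⇒α : W L0 σ z y ≤ W L0 σ y z → ModeIs (W L0 σ′ z y) (W L0 σ′ y z) α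
    mode-≥⇒α Wzy≤Wyz = begin
      suc (W L0 σ′ z y)     ≡⟨ cong suc W′-zy ⟩
      suc (q ⊓ suc (suc p)) ≡⟨ cong suc (m≤n⇒m⊓n≡m (≤-trans q≤p (m≤n+m p 2))) ⟩
      suc q                 ≡⟨ sym (m≥n⇒m⊓n≡n (s≤s q≤p)) ⟩
      suc p ⊓ suc q         ≡⟨ sym W′-yz ⟩
      W L0 σ′ y z           ∎
      where
        open ≡-Reasoning
        q≤p = subst (_≤ p) W-zy Wzy≤Wyz

  mode-α⇒β : ModeIs (W L0 σ y z) (W L0 σ z y) α → ModeIs (W L0 σ′ z y) (W L0 σ′ y z) β
  mode-α⇒β sp≡Wzy = begin
    W L0 σ′ z y           ≡⟨ W′-zy ⟩
    q ⊓ suc (suc p)       ≡⟨ cong (_⊓ suc (suc p)) (sym sp≡q) ⟩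
    suc p ⊓ suc (suc p)   ≡⟨ cong (λ t → suc p ⊓ suc t) sp≡q ⟩
    suc p ⊓ suc q         ≡⟨ sym W′-yz ⟩
    W L0 σ′ y z           ∎
    where
      open ≡-Reasoning
      sp≡q = trans sp≡Wzy W-zy

  mode-β⇒α : ModeIs (W L0 σ y z) (W L0 σ z y) β → ModeIs (W L0 σ′ z y) (W L0 σ′ y z) α
  mode-β⇒α Wyz≡Wzy = mode-≥⇒α (≤-reflexive (sym Wyz≡Wzy))

  mode-γ⇒α : ModeIs (W L0 σ y z) (W L0 σ z y) γ → ModeIs (W L0 σ′ z y) (W L0 σ′ y z) α
  mode-γ⇒α Wyz≡sWzy = mode-≥⇒α (≤-trans (n≤1+n _) (≤-reflexive (sym Wyz≡sWzy)))

module MoveForward (C : Config m) {y z : Fin m} (y≺z : y ≺[ lst C ] z) where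
  private
    L = lst C

  L′ : Move → List (Fin m)
  L′ mv = lst (fpmStep C (z , mv))

  θ′ : Move → Fin m → Fin m
  θ′ mv = θ (fpmStep C (z , mv))

  FlavorAfter : Move → Fin m → Fin m → Flavor → Set
  FlavorAfter mv = FlavorIs (L′ mv) (θ′ mv)

  module _ (mv : Move) (k≤z : insertionPoint C z mv ≤ pos L z) (θy⪯y : θ C y ⪯[ L ] y) where
    private
      k = insertionPoint C z mv

      pos′≡ : (v : Fin m) → pos (L′ mv) v ≡ pos (moveTo k z L) v
      pos′≡ v = cong (λ l → pos l v) (lst-fpmStep C z mv)

      pos′-z : pos (L′ mv) z ≡ k
      pos′-z = trans (pos′≡ z) (pos-moveTo-self L k≤z)

      pos′-< : pos L v < pos L z → pos L v < k → pos (L′ mv) v ≡ pos L v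
      pos′-< {v = v} v<z v<k = trans (pos′≡ v) (pos-moveTo-< L v<z v<k)

      pos′-≥ : pos L v < pos L z → k ≤ pos L v → pos (L′ mv) v ≡ suc (pos L v)
      pos′-≥ {v = v} v<z k≤v = trans (pos′≡ v) (pos-moveTo-≥ L v<z k≤v)

      θy≺z : θ C y ≺[ L ] z
      θy≺z = ≤-<-trans θy⪯y y≺z

      θ′y≡θy : θ′ mv y ≡ θ C y
      θ′y≡θy = θ-fpmStep-other C mv (λ y≡z → <-irrefl (cong (pos L) y≡z) y≺z)
                                    (λ θy≡z → <-irrefl (cong (pos L) θy≡z) θy≺z)

      z∈L′ : z ∈ L′ mv
      z∈L′ = subst (z ∈_) (sym (lst-fpmStep C z mv)) (∈-moveTo k L)

      θ′z-front : pos (L′ mv) (θ′ mv z) ≡ 0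
      θ′z-front = trans (cong (pos (L′ mv)) (θ-fpmStep-self C z mv)) (pos-front (L′ mv) z)

      θ′z-first : θ′ mv z ≡ v ⊎ θ′ mv z ≺[ L′ mv ] v
      θ′z-first = subst (λ t → t ≡ _ ⊎ t ≺[ L′ mv ] _) (sym (θ-fpmStep-self C z mv)) (front-first z∈L′)

    z-first-d : k ≤ pos L (θ C y) → z ≺[ L′ mv ] y × FlavorAfter mv z y d
    z-first-d k≤θy
      rewrite pos′-z | pos′-≥ y≺z (≤-trans k≤θy θy⪯y) | θ′y≡θy | pos′-≥ θy≺z k≤θy | θ′z-front
      = s≤s (≤-trans k≤θy θy⪯y) , z≤n , s≤s k≤θy , s≤s θy⪯y

    z-first-oe : pos L (θ C y) < k → k ≤ pos L y →
                 z ≺[ L′ mv ] y × (FlavorAfter mv z y o ⊎ FlavorAfter mv z y e)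
    z-first-oe θy<k k≤y =
      z≺y , [ (λ θz≡θy → inj₂ (θz≡θy , θy⪯z , z≺y))
            , (λ θz≺θy → inj₁ (θz≺θy , θy⪯z , z≺y)) ]′ θ′z-first
      where
        z≺y : z ≺[ L′ mv ] y
        z≺y rewrite pos′-z | pos′-≥ y≺z k≤y = s≤s k≤y
        θy⪯z : θ′ mv y ⪯[ L′ mv ] z
        θy⪯z rewrite θ′y≡θy | pos′-< θy≺z θy<k | pos′-z = <⇒≤ θy<k

    y-first-ne : pos L y < k →
                 y ≺[ L′ mv ] z × (FlavorAfter mv y z n ⊎ FlavorAfter mv y z e)
    y-first-ne y<k =
      y≺z′ , [ (λ θz≡θy → inj₂ (sym θz≡θy , θz⪯y , y≺z′))
             , (λ θz≺θy → inj₁ (θz≺θy , θy⪯y′ , y≺z′)) ]′ θ′z-first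
      where
        y≺z′ : y ≺[ L′ mv ] z
        y≺z′ rewrite pos′-< y≺z y<k | pos′-z = y<k
        θy⪯y′ : θ′ mv y ⪯[ L′ mv ] y
        θy⪯y′ rewrite θ′y≡θy | pos′-< θy≺z (≤-<-trans θy⪯y y<k) | pos′-< y≺z y<k = θy⪯y
        θz⪯y : θ′ mv z ⪯[ L′ mv ] y
        θz⪯y rewrite θ′z-front = z≤n

  flavor⇒θy⪯y : (ω : Flavor) → FlavorIs L (θ C) y z ω → θ C y ⪯[ L ] y
  flavor⇒θy⪯y = FlavorIs⇒θ⪯

  full-move : (ω : Flavor) → FlavorIs L (θ C) y z ω → z ≺[ L′ full ] y × FlavorAfter full z y d
  full-move ω fl = z-first-d full z≤n (flavor⇒θy⪯y ω fl) z≤n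

  partial-move-d : FlavorIs L (θ C) y z d →
    y ≺[ L′ partial ] z × (FlavorAfter partial y z n ⊎ FlavorAfter partial y z e)
  partial-move-d (θy⪯y , y≺θz , θz⪯z) = y-first-ne partial θz⪯z θy⪯y y≺θz

  partial-move-o : FlavorIs L (θ C) y z o →
    z ≺[ L′ partial ] y × (FlavorAfter partial z y o ⊎ FlavorAfter partial z y e)
  partial-move-o fl@(θy≺θz , θz⪯y , _) =
    z-first-oe partial (≤-trans θz⪯y (<⇒≤ y≺z)) (flavor⇒θy⪯y o fl) θy≺θz θz⪯y

  partial-move-e : FlavorIs L (θ C) y z e → z ≺[ L′ partial ] y × FlavorAfter partial z y d
  partial-move-e fl@(θy≡θz , θz⪯y , _) =
    z-first-d partial (≤-trans θz⪯y (<⇒≤ y≺z)) (flavor⇒θy⪯y e fl)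
              (≤-reflexive (cong (pos L) (sym θy≡θz)))

  partial-move-n : FlavorIs L (θ C) y z n → z ≺[ L′ partial ] y × FlavorAfter partial z y d
  partial-move-n (θz≺θy , θy⪯y , _) =
    z-first-d partial (<⇒≤ (<-≤-trans θz≺θy (≤-trans θy⪯y (<⇒≤ y≺z)))) θy⪯y (<⇒≤ θz≺θy)

module StateTransitions {m : ℕ} (L0 : List (Fin m)) (pre : List (Fin m × Move)) {z y : Fin m}
                        (y∈L0 : y ∈ L0) (y≺z : y ≺[ lst (run L0 pre) ] z) where
  private
    σ = map proj₁ pre
    σ′ = σ ∷ʳ z
    C = run L0 pre

    S : Mode → Flavor → Set
    S = StateIs L0 σ C y z

    T : Move → Mode → Flavor → Set
    T mv = PairState L0 σ′ (fpmStep C (z , mv)) z y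

    open ServeLater L0 σ y∈L0 (λ y≡z → <-irrefl (cong (pos (lst C)) y≡z) y≺z)
    open MoveForward C y≺z

    -- The state indices are explicit: ModeIs and FlavorIs compute on them, so they cannot be inferred.
    z-first : ∀ mv ξ ω → z ≺[ L′ mv ] y × FlavorAfter mv z y ω →
              ModeIs (W L0 σ′ z y) (W L0 σ′ y z) ξ → T mv ξ ω
    z-first mv ξ ω (z≺y , fl) md = inj₁ (z≺y , md , fl)

    z-first⊎ : ∀ mv ξ ω₁ ω₂ →
               z ≺[ L′ mv ] y × (FlavorAfter mv z y ω₁ ⊎ FlavorAfter mv z y ω₂) →
               ModeIs (W L0 σ′ z y) (W L0 σ′ y z) ξ → T mv ξ ω₁ ⊎ T mv ξ ω₂
    z-first⊎ mv ξ ω₁ ω₂ (z≺y , inj₁ fl) md = inj₁ (inj₁ (z≺y , md , fl))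
    z-first⊎ mv ξ ω₁ ω₂ (z≺y , inj₂ fl) md = inj₂ (inj₁ (z≺y , md , fl))

    y-first⊎ : ∀ mv ξ ω₁ ω₂ →
               y ≺[ L′ mv ] z × (FlavorAfter mv y z ω₁ ⊎ FlavorAfter mv y z ω₂) →
               ModeIs (W L0 σ′ y z) (W L0 σ′ z y) ξ → T mv ξ ω₁ ⊎ T mv ξ ω₂
    y-first⊎ mv ξ ω₁ ω₂ (y≺z′ , inj₁ fl) md = inj₁ (inj₂ (y≺z′ , md , fl))
    y-first⊎ mv ξ ω₁ ω₂ (y≺z′ , inj₂ fl) md = inj₂ (inj₂ (y≺z′ , md , fl))

  full-transitions : Transitions full S (T full)
  full-transitions =
      (λ (md , fl) → z-first full β d (full-move d fl) (mode-α⇒β md))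
    , (λ (md , fl) → z-first full α d (full-move d fl) (mode-β⇒α md))
    , [ (λ (md , fl) → z-first full β d (full-move o fl) (mode-α⇒β md))
      , (λ (md , fl) → z-first full β d (full-move e fl) (mode-α⇒β md)) ]′
    , (λ (md , fl) → z-first full α d (full-move o fl) (mode-β⇒α md))
    , [ (λ (md , fl) → z-first full α d (full-move n fl) (mode-β⇒α md))
      , (λ (md , fl) → z-first full α d (full-move e fl) (mode-β⇒α md)) ]′
    , [ (λ (md , fl) → z-first full α d (full-move n fl) (mode-γ⇒α md))
      , (λ (md , fl) → z-first full α d (full-move e fl) (mode-γ⇒α md)) ]′

  -- With y first the same mode facts read backwards: α with z first is γ with y first.
  partial-transitions : Transitions partial S (T partial)
  partial-transitions =
      (λ (md , fl) → y-first⊎ partial β n e (partial-move-d fl) (sym (mode-α⇒β md)))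
    , (λ (md , fl) → y-first⊎ partial γ n e (partial-move-d fl) (sym (mode-β⇒α md)))
    , [ (λ (md , fl) → [ (λ βo → inj₂ (inj₁ βo)) , (λ βe → inj₂ (inj₂ (inj₂ βe))) ]′
                         (z-first⊎ partial β o e (partial-move-o fl) (mode-α⇒β md)))
      , (λ (md , fl) → inj₁ (z-first partial β d (partial-move-e fl) (mode-α⇒β md))) ]′
    , (λ (md , fl) → z-first⊎ partial α o e (partial-move-o fl) (mode-β⇒α md))
    , [ (λ (md , fl) → z-first partial α d (partial-move-n fl) (mode-β⇒α md))
      , (λ (md , fl) → z-first partial α d (partial-move-e fl) (mode-β⇒α md)) ]′
    , [ (λ (md , fl) → z-first partial α d (partial-move-n fl) (mode-γ⇒α md))
      , (λ (md , fl) → z-first partial α d (partial-move-e fl) (mode-γ⇒α md)) ]′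

  transitions : (mv : Move) → Transitions mv S (T mv)
  transitions partial = partial-transitions
  transitions full    = full-transitions

lemma4p4 : (N : ℕ) (L0 : List (Fin N)) → L0 ↭ allFin N →
           (pre : List (Fin N × Move)) (z y : Fin N) (mv : Move) →
           y ≺[ lst (run L0 pre) ] z →
           Transitions mv
             (λ ξ ω → StateIs L0 (map proj₁ pre) (run L0 pre) y z ξ ω)
             (λ ξ ω → PairState L0 (map proj₁ pre ∷ʳ z) (fpmStep (run L0 pre) (z , mv)) z y ξ ω)
lemma4p4 N L0 L0↭allFin pre z y mv y≺z = StateTransitions.transitions L0 pre y∈L0 y≺z mv
  where
    y∈L0 : y ∈ L0
    y∈L0 = ∈-resp-↭ (↭-sym L0↭allFin) (∈-allFin y)
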